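{- If $T$ is a finite triangle-tree, then $\tau(T)=\nu(T)$.
   Context: A graph $T$ is a triangle-tree if it can be obtained by starting with a single edge (the root) and repeatedly adding a triangle consisting of an already present edge and a new vertex (i.e. adding a new vertex $w$ and the two edges joining $w$ to the ends of an existing edge). For a finite graph $H$, $\nu(H)$ is the maximum number of pairwise edge-disjoint triangles in $H$, and $\tau(H)$ is the minimum size of a set $F$ of edges of $H$ such that every triangle of $H$ contains an edge of $F$. -}

module Defs where

open import Data.Nat using (ℕ; zero; suc; _≤_)
open import Data.Fin using (Fin; zero; suc; inject₁; fromℕ; _<_)
open import Data.Product using (Σ; ∃; _×_; _,_)
open import Data.Sum using (_⊎_)
open import Data.List using (List; []; _∷_; _++_; map; length)
open import Data.List.Membership.Propositional using (_∈_)
open import Data.List.Relation.Unary.All using (All)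
open import Data.List.Relation.Unary.Unique.Propositional using (Unique)
open import Data.List.Relation.Unary.AllPairs using (AllPairs)
open import Relation.Binary.PropositionalEquality using (_≡_; _≢_)
open import Relation.Nullary using (¬_)

-- A finite (simple) graph on vertex set Fin n is given by a list of edges;
-- an edge is stored as an ordered pair (x , y) representing {x , y}.
Edge : ℕ → Set
Edge n = Fin n × Fin n

Adj : ∀ {n} → List (Edge n) → Fin n → Fin n → Set
Adj E x y = ((x , y) ∈ E) ⊎ ((y , x) ∈ E)

liftEdge : ∀ {n} → Edge n → Edge (suc n)
liftEdge (x , y) = (inject₁ x , inject₁ y)

-- Triangle-trees: start with a single edge (the root) on two vertices, then
-- repeatedly add a new vertex w = fromℕ n adjacent to both ends of an
-- existing edge.
data TriangleTree : (n : ℕ) → List (Edge n) → Set where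
  root : TriangleTree 2 ((zero , suc zero) ∷ [])
  grow : ∀ {n E u v} → TriangleTree n E → (u , v) ∈ E →
         TriangleTree (suc n)
           (map liftEdge E ++ ((inject₁ u , fromℕ n) ∷ (inject₁ v , fromℕ n) ∷ []))

record Triangle {n : ℕ} (E : List (Edge n)) : Set where
  constructor tri
  field
    a b c : Fin n
    a<b : a < b
    b<c : b < c
    ab : Adj E a b
    bc : Adj E b c
    ac : Adj E a c

open Triangle public

_∈ᵗ_ : ∀ {n} {E : List (Edge n)} → Fin n → Triangle E → Set
x ∈ᵗ t = (x ≡ a t) ⊎ (x ≡ b t) ⊎ (x ≡ c t)

-- two triangles share an edge iff they share two distinct vertices
SharesEdge : ∀ {n} {E : List (Edge n)} → Triangle E → Triangle E → Set
SharesEdge t s = Σ _ λ x → Σ _ λ y →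
  x ≢ y × x ∈ᵗ t × y ∈ᵗ t × x ∈ᵗ s × y ∈ᵗ s

EdgeDisjoint : ∀ {n} {E : List (Edge n)} → Triangle E → Triangle E → Set
EdgeDisjoint t s = ¬ SharesEdge t s

IsPacking : ∀ {n} (E : List (Edge n)) → List (Triangle E) → Set
IsPacking E P = AllPairs EdgeDisjoint P

_⊂ᵗ_ : ∀ {n} {E : List (Edge n)} → Edge n → Triangle E → Set
(x , y) ⊂ᵗ t = x ∈ᵗ t × y ∈ᵗ t

IsCover : ∀ {n} (E : List (Edge n)) → List (Edge n) → Set
IsCover E F = Unique F × All (_∈ E) F ×
  ((t : Triangle E) → Σ _ λ e → e ∈ F × e ⊂ᵗ t)

IsNu : ∀ {n} (E : List (Edge n)) → ℕ → Set
IsNu E k = (Σ (List (Triangle E)) λ P → IsPacking E P × length P ≡ k) ×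
           ((P : List (Triangle E)) → IsPacking E P → length P ≤ k)

IsTau : {n : ℕ} (E : List (Edge n)) → ℕ → Set
IsTau {n} E k = (Σ (List (Edge n)) λ F → IsCover E F × length F ≡ k) ×
            ((F : List (Edge n)) → IsCover E F → k ≤ length F)

module Submission where

-- Weak duality ν ≤ τ holds in every loopless graph: a cover must contain,
-- for each triangle of a packing, an edge of that triangle, and these edges
-- are pairwise distinct because the triangles are edge-disjoint (pigeonhole).
--
-- For the converse we use one structural property of triangle-trees: every
-- vertex is the largest corner (the "top") of at most one triangle.  So the
-- triangles can be listed with strictly decreasing tops ("a top-ordered
-- listing").  Scan such a listing greedily, keeping a triangle t unless the
-- base (the edge opposite the top) of an already kept triangle lies in t.
-- A kept t is edge-disjoint from the earlier kept triangles p: they have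
-- larger tops, so an edge shared with t avoids the top of p and is its base.
-- Hence the kept triangles form a packing whose bases cover every triangle,
-- and weak duality shows that its size is both ν and τ.
--
-- Finally, triangle-trees are loopless and admit a top-ordered listing, by
-- induction on their construction: the only triangle through the newest
-- vertex is the one created together with it.

open import Defs
open import Data.Nat using (ℕ; suc; _≤_; z≤n; s≤s)
import Data.Nat as ℕ
import Data.Nat.Properties as ℕₚ
open import Data.Fin using (Fin; zero; suc; toℕ; _<_; _≟_; inject₁; fromℕ)
open import Data.Fin.Properties using (toℕ-inject₁; toℕ-fromℕ; inject₁ℕ<; inject₁-injective; fromℕ≢inject₁; <⇒≢; <-cmp)
open import Data.Fin.Relation.Unary.Top using (view; ‵fromℕ; ‵inj₁)
open import Data.Product using (Σ; ∃; ∃₂; _×_; _,_; proj₁; proj₂)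
open import Data.Sum using (_⊎_; inj₁; inj₂; swap)
open import Data.Empty using (⊥-elim)
open import Data.List using (List; []; _∷_; _++_; map; length)
open import Data.List.Properties using (length-map; length-removeAt′)
open import Data.List.Membership.Propositional using (_∈_; find)
open import Data.List.Membership.Propositional.Properties using (∈-map⁺; ∈-map⁻; ∈-++⁻; ∈-++⁺ˡ; ∈-++⁺ʳ)
open import Data.List.Relation.Unary.Any using (here; there; index; _─_; any?)
open import Data.List.Relation.Unary.All as All using (All; []; _∷_)
import Data.List.Relation.Unary.All.Properties as AllProps
open import Data.List.Relation.Unary.AllPairs as AllPairs using (AllPairs; []; _∷_)
import Data.List.Relation.Unary.AllPairs.Properties as AllPairsProps
open import Data.List.Relation.Unary.Unique.Propositional using (Unique)
open import Function using (_∘_)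
open import Relation.Binary using (tri<; tri≈; tri>)
open import Relation.Binary.PropositionalEquality using (_≡_; _≢_; refl; sym; subst; subst₂)
open import Relation.Nullary using (Dec; yes; no)
open import Relation.Nullary.Decidable using (_⊎-dec_; _×-dec_)

module _ {A : Set} where

  ∈-─ : ∀ {x y : A} {F : List A} (x∈F : x ∈ F) → y ∈ F → y ≢ x → y ∈ (F ─ x∈F)
  ∈-─ (here refl) (here refl) y≢x = ⊥-elim (y≢x refl)
  ∈-─ (here _)    (there y∈F) _   = y∈F
  ∈-─ (there _)   (here y≡z)  _   = here y≡z
  ∈-─ (there x∈F) (there y∈F) y≢x = there (∈-─ x∈F y∈F y≢x)

  distinct⊆⇒length≤ : (xs F : List A) → AllPairs _≢_ xs → All (_∈ F) xs →
                      length xs ≤ length F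
  distinct⊆⇒length≤ []       F _                  _           = z≤n
  distinct⊆⇒length≤ (x ∷ xs) F (x≢xs ∷ distinct) (x∈F ∷ xs⊆F) = begin
    suc (length xs)        ≤⟨ s≤s (distinct⊆⇒length≤ xs (F ─ x∈F) distinct xs⊆F∖x) ⟩
    suc (length (F ─ x∈F)) ≡⟨ sym (length-removeAt′ F (index x∈F)) ⟩
    length F               ∎
    where
    open ℕₚ.≤-Reasoning
    xs⊆F∖x : All (_∈ (F ─ x∈F)) xs
    xs⊆F∖x = All.zipWith (λ (x≢y , y∈F) → ∈-─ x∈F y∈F (x≢y ∘ sym)) (x≢xs , xs⊆F)

module Triangles {n : ℕ} (E : List (Edge n)) where

  Loopless : Set
  Loopless = ∀ {x y} → (x , y) ∈ E → x ≢ y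

  a≢b : (t : Triangle E) → a t ≢ b t
  a≢b t = <⇒≢ (a<b t)

  corner≤top : ∀ {x} (s : Triangle E) → x ∈ᵗ s → toℕ x ℕ.≤ toℕ (c s)
  corner≤top s (inj₁ refl)        = ℕₚ.<⇒≤ (ℕₚ.<-trans (a<b s) (b<c s))
  corner≤top s (inj₂ (inj₁ refl)) = ℕₚ.<⇒≤ (b<c s)
  corner≤top s (inj₂ (inj₂ refl)) = ℕₚ.≤-refl

  _∈ᵗ?_ : (x : Fin n) (t : Triangle E) → Dec (x ∈ᵗ t)
  x ∈ᵗ? t = (x ≟ a t) ⊎-dec ((x ≟ b t) ⊎-dec (x ≟ c t))

  -- Weak duality ν ≤ τ: distinct triangles of a packing need distinct
  -- cover edges, since a cover edge lies in every triangle it hits.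
  packing≤cover : Loopless → (Q : List (Triangle E)) (F : List (Edge n)) →
                  IsPacking E Q → IsCover E F → length Q ≤ length F
  packing≤cover loopless Q F packing (_ , F⊆E , covers) =
    subst (_≤ length F) (length-map hit Q)
      (distinct⊆⇒length≤ (map hit Q) F
        (AllPairsProps.map⁺ (AllPairs.map hits-differ packing))
        (AllProps.map⁺ (All.tabulate (λ {q} _ → proj₁ (proj₂ (covers q))))))
    where
    hit : Triangle E → Edge n
    hit q = proj₁ (covers q)
    hits-differ : ∀ {q r : Triangle E} → EdgeDisjoint q r → hit q ≢ hit r
    hits-differ {q} {r} disjoint same with covers q | covers r
    ... | (x , y) , xy∈F , x∈q , y∈q | _ , _ , x∈r , y∈r with refl ← same =
      disjoint (x , y , loopless (All.lookup F⊆E xy∈F) , x∈q , y∈q , x∈r , y∈r)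

  edgeOf : ∀ {x y} → Adj E x y → Edge n
  edgeOf {x} {y} (inj₁ _) = (x , y)
  edgeOf {x} {y} (inj₂ _) = (y , x)

  edgeOf∈E : ∀ {x y} (xy : Adj E x y) → edgeOf xy ∈ E
  edgeOf∈E (inj₁ xy∈E) = xy∈E
  edgeOf∈E (inj₂ yx∈E) = yx∈E

  edgeOf⊂ : ∀ {x y} (xy : Adj E x y) {s : Triangle E} →
            x ∈ᵗ s × y ∈ᵗ s → edgeOf xy ⊂ᵗ s
  edgeOf⊂ (inj₁ _) (x∈s , y∈s) = x∈s , y∈s
  edgeOf⊂ (inj₂ _) (x∈s , y∈s) = y∈s , x∈s

  ⊂edgeOf : ∀ {x y} (xy : Adj E x y) {s : Triangle E} →
            edgeOf xy ⊂ᵗ s → x ∈ᵗ s × y ∈ᵗ s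
  ⊂edgeOf (inj₁ _) (x∈s , y∈s) = x∈s , y∈s
  ⊂edgeOf (inj₂ _) (y∈s , x∈s) = x∈s , y∈s

  base : Triangle E → Edge n
  base t = edgeOf (ab t)

  BaseInside : Triangle E → Triangle E → Set
  BaseInside p t = a p ∈ᵗ t × b p ∈ᵗ t

  baseInside-self : (t : Triangle E) → BaseInside t t
  baseInside-self t = inj₁ refl , inj₂ (inj₁ refl)

  distinct-bases : ∀ {Q} → IsPacking E Q → Unique (map base Q)
  distinct-bases packing = AllPairsProps.map⁺ (AllPairs.map (λ {t} {p} → base-differ {t} {p}) packing)
    where
    base-differ : ∀ {t p : Triangle E} → EdgeDisjoint t p → base t ≢ base p
    base-differ {t} {p} disjoint same =
      let at∈p , bt∈p = ⊂edgeOf (ab t) {p} (subst (_⊂ᵗ p) (sym same) (edgeOf⊂ (ab p) {p} (baseInside-self p)))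
      in disjoint (a t , b t , a≢b t , inj₁ refl , inj₂ (inj₁ refl) , at∈p , bt∈p)

  -- If t lies entirely below the top of p, an edge shared by t and p
  -- avoids that top, hence it is the base of p.
  shared-edge-is-base : (t p : Triangle E) → c t < c p → SharesEdge t p → BaseInside p t
  shared-edge-is-base t p ct<cp (x , y , x≢y , x∈t , y∈t , x∈p , y∈p) = corners x∈p y∈p
    where
    not-top : ∀ {z} → z ∈ᵗ t → z ≢ c p
    not-top z∈t refl = ℕₚ.<-irrefl refl (ℕₚ.≤-<-trans (corner≤top t z∈t) ct<cp)
    corners : x ∈ᵗ p → y ∈ᵗ p → BaseInside p t
    corners (inj₂ (inj₂ x≡c)) _                 = ⊥-elim (not-top x∈t x≡c)
    corners _                 (inj₂ (inj₂ y≡c)) = ⊥-elim (not-top y∈t y≡c)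
    corners (inj₁ refl)        (inj₁ refl)        = ⊥-elim (x≢y refl)
    corners (inj₁ refl)        (inj₂ (inj₁ refl)) = x∈t , y∈t
    corners (inj₂ (inj₁ refl)) (inj₁ refl)        = y∈t , x∈t
    corners (inj₂ (inj₁ refl)) (inj₂ (inj₁ refl)) = ⊥-elim (x≢y refl)

  Above : Triangle E → Triangle E → Set
  Above p t = c t < c p

  TopOrdered : List (Triangle E) → Set
  TopOrdered = AllPairs Above

  -- Triangles are compared by corners only: adjacency proofs are not unique.
  SameCorners : Triangle E → Triangle E → Set
  SameCorners s t = a s ≡ a t × b s ≡ b t × c s ≡ c t

  record TriangleListing : Set where
    field
      triangles  : List (Triangle E)
      topOrdered : TopOrdered triangles
      complete   : ∀ t → ∃ λ s → s ∈ triangles × SameCorners s t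

  CoveredBy : List (Triangle E) → Triangle E → Set
  CoveredBy Q t = ∃ λ p → p ∈ Q × BaseInside p t

  record GreedyResult (P L : List (Triangle E)) : Set where
    field
      kept    : List (Triangle E)
      packing : IsPacking E kept
      extends : ∀ {p} → p ∈ P → p ∈ kept
      covers  : All (CoveredBy kept) L

  open GreedyResult

  -- Scan L, keeping a triangle unless it contains the base of a kept one.
  -- Invariant: the kept triangles form a packing and lie above all of L.
  greedy : (P L : List (Triangle E)) → TopOrdered L → IsPacking E P →
           All (λ p → All (Above p) L) P → GreedyResult P L
  greedy P [] _ P-packing _ =
    record { kept = P ; packing = P-packing ; extends = λ p∈P → p∈P ; covers = [] }
  greedy P (t ∷ L) (t-above ∷ ordered) P-packing P-above
    with any? (λ p → (a p ∈ᵗ? t) ×-dec (b p ∈ᵗ? t)) P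
  ... | yes some-base-inside with find some-base-inside
  ...   | p , p∈P , inside =
    record { kept = kept rest ; packing = packing rest ; extends = extends rest
           ; covers = (p , extends rest p∈P , inside) ∷ covers rest }
    where
    rest : GreedyResult P L
    rest = greedy P L ordered P-packing (All.map All.tail P-above)
  greedy P (t ∷ L) (t-above ∷ ordered) P-packing P-above | no no-base-inside =
    record { kept = kept rest ; packing = packing rest ; extends = extends rest ∘ there
           ; covers = (t , extends rest (here refl) , baseInside-self t) ∷ covers rest }
    where
    t-disjoint : All (EdgeDisjoint t) P
    t-disjoint = All.zipWith
      (λ {p} (outside , p-above-t) → outside ∘ shared-edge-is-base t p (All.head p-above-t))
      (AllProps.¬Any⇒All¬ P no-base-inside , P-above)
    rest : GreedyResult (t ∷ P) L
    rest = greedy (t ∷ P) L ordered (t-disjoint ∷ P-packing) (t-above ∷ All.map All.tail P-above)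

  -- In a loopless graph with a top-ordered listing, the greedy packing and
  -- the set of its bases witness τ = ν.
  τ≡ν : Loopless → TriangleListing → Σ ℕ (λ k → IsTau E k × IsNu E k)
  τ≡ν loopless listing = length Q , (tau , nu)
    where
    open TriangleListing listing
    result : GreedyResult [] triangles
    result = greedy [] triangles topOrdered [] []
    Q : List (Triangle E)
    Q = kept result
    covered : (t : Triangle E) → Σ (Edge n) λ e → e ∈ map base Q × e ⊂ᵗ t
    covered t with complete t
    ... | s , s∈L , (refl , refl , refl) with All.lookup (covers result) s∈L
    ...   | p , p∈Q , inside = base p , ∈-map⁺ base p∈Q , edgeOf⊂ (ab p) {t} inside
    cover : IsCover E (map base Q)
    cover = distinct-bases (packing result)
          , AllProps.map⁺ (All.tabulate (λ {p} _ → edgeOf∈E (ab p)))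
          , covered
    tau : IsTau E (length Q)
    tau = (map base Q , cover , length-map base Q)
        , λ F F-cover → packing≤cover loopless Q F (packing result) F-cover
    nu : IsNu E (length Q)
    nu = (Q , packing result , refl)
       , λ P P-packing → subst (length P ≤_) (length-map base Q)
                           (packing≤cover loopless P (map base Q) P-packing cover)

open Triangles using (Loopless; TriangleListing)

inject₁-<⁺ : ∀ {m} {x y : Fin m} → x < y → inject₁ x < inject₁ y
inject₁-<⁺ {x = x} {y} = subst₂ ℕ._<_ (sym (toℕ-inject₁ x)) (sym (toℕ-inject₁ y))

inject₁-<⁻ : ∀ {m} {x y : Fin m} → inject₁ x < inject₁ y → x < y
inject₁-<⁻ {x = x} {y} = subst₂ ℕ._<_ (toℕ-inject₁ x) (toℕ-inject₁ y)

inject₁<fromℕ : ∀ {m} (x : Fin m) → inject₁ x < fromℕ m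
inject₁<fromℕ {m} x = subst (ℕ._<_ _) (sym (toℕ-fromℕ m)) (inject₁ℕ< x)

below-inject₁ : ∀ {m} {x : Fin (suc m)} {y : Fin m} → x < inject₁ y → ∃ λ x′ → x ≡ inject₁ x′
below-inject₁ {m} {x} {y} x<y with view x
... | ‵fromℕ  = ⊥-elim (ℕₚ.<-asym (subst (ℕ._< toℕ (inject₁ y)) (toℕ-fromℕ m) x<y) (inject₁ℕ< y))
... | ‵inj₁ _ = _ , refl

module Growth {n : ℕ} {E : List (Edge n)} {u v : Fin n} (uv∈E : (u , v) ∈ E) where

  w : Fin (suc n)
  w = fromℕ n

  E′ : List (Edge (suc n))
  E′ = map liftEdge E ++ ((inject₁ u , fromℕ n) ∷ (inject₁ v , fromℕ n) ∷ [])

  edge-of-E′ : ∀ {x y} → (x , y) ∈ E′ →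
    (∃₂ λ x₀ y₀ → (x₀ , y₀) ∈ E × x ≡ inject₁ x₀ × y ≡ inject₁ y₀) ⊎
    ((x ≡ inject₁ u ⊎ x ≡ inject₁ v) × y ≡ w)
  edge-of-E′ xy∈E′ with ∈-++⁻ (map liftEdge E) xy∈E′
  ... | inj₁ xy∈old with ∈-map⁻ liftEdge xy∈old
  ...   | (x₀ , y₀) , e∈E , refl = inj₁ (x₀ , y₀ , e∈E , refl , refl)
  edge-of-E′ _ | inj₂ (here refl)         = inj₂ (inj₁ refl , refl)
  edge-of-E′ _ | inj₂ (there (here refl)) = inj₂ (inj₂ refl , refl)

  -- the new edges join w to old vertices, so no loop is created
  loopless : Loopless E → Loopless E′
  loopless loopless-E xy∈E′ x≡y with edge-of-E′ xy∈E′
  ... | inj₁ (_ , _ , e∈E , refl , refl) = loopless-E e∈E (inject₁-injective x≡y)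
  ... | inj₂ (inj₁ refl , refl)          = fromℕ≢inject₁ (sym x≡y)
  ... | inj₂ (inj₂ refl , refl)          = fromℕ≢inject₁ (sym x≡y)

  lift-adj : ∀ {x y} → Adj E x y → Adj E′ (inject₁ x) (inject₁ y)
  lift-adj (inj₁ xy∈E) = inj₁ (∈-++⁺ˡ (∈-map⁺ liftEdge xy∈E))
  lift-adj (inj₂ yx∈E) = inj₂ (∈-++⁺ˡ (∈-map⁺ liftEdge yx∈E))

  lower-edge : ∀ {x y} → (inject₁ x , inject₁ y) ∈ E′ → (x , y) ∈ E
  lower-edge xy∈E′ with edge-of-E′ xy∈E′
  ... | inj₁ (_ , _ , e∈E , x≡ , y≡)
    rewrite inject₁-injective x≡ | inject₁-injective y≡ = e∈E
  ... | inj₂ (_ , y≡w) = ⊥-elim (fromℕ≢inject₁ (sym y≡w))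

  lower-adj : ∀ {x y} → Adj E′ (inject₁ x) (inject₁ y) → Adj E x y
  lower-adj (inj₁ xy∈E′) = inj₁ (lower-edge xy∈E′)
  lower-adj (inj₂ yx∈E′) = inj₂ (lower-edge yx∈E′)

  neighbour-of-w : ∀ {x} → Adj E′ x w → x ≡ inject₁ u ⊎ x ≡ inject₁ v
  neighbour-of-w (inj₁ xw∈E′) with edge-of-E′ xw∈E′
  ... | inj₁ (_ , _ , _ , _ , w≡) = ⊥-elim (fromℕ≢inject₁ w≡)
  ... | inj₂ (x≡uv , _)           = x≡uv
  neighbour-of-w (inj₂ wx∈E′) with edge-of-E′ wx∈E′
  ... | inj₁ (_ , _ , _ , w≡ , _)        = ⊥-elim (fromℕ≢inject₁ w≡)
  ... | inj₂ (inj₁ w≡u , _) = ⊥-elim (fromℕ≢inject₁ w≡u)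
  ... | inj₂ (inj₂ w≡v , _) = ⊥-elim (fromℕ≢inject₁ w≡v)

  lift-triangle : Triangle E → Triangle E′
  lift-triangle (tri x y z x<y y<z xy yz xz) =
    tri (inject₁ x) (inject₁ y) (inject₁ z) (inject₁-<⁺ x<y) (inject₁-<⁺ y<z)
        (lift-adj xy) (lift-adj yz) (lift-adj xz)

  uw : Adj E′ (inject₁ u) w
  uw = inj₁ (∈-++⁺ʳ (map liftEdge E) (here refl))

  vw : Adj E′ (inject₁ v) w
  vw = inj₁ (∈-++⁺ʳ (map liftEdge E) (there (here refl)))

  new-triangle : u ≢ v → Σ (Triangle E′) λ N →
    c N ≡ w × (∀ {x} → x ≡ inject₁ u ⊎ x ≡ inject₁ v → x ≡ a N ⊎ x ≡ b N)
  new-triangle u≢v with <-cmp u v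
  ... | tri< u<v _ _ = tri (inject₁ u) (inject₁ v) w (inject₁-<⁺ u<v) (inject₁<fromℕ v)
                           (lift-adj (inj₁ uv∈E)) vw uw , refl , λ x≡uv → x≡uv
  ... | tri≈ _ u≡v _ = ⊥-elim (u≢v u≡v)
  ... | tri> _ _ v<u = tri (inject₁ v) (inject₁ u) w (inject₁-<⁺ v<u) (inject₁<fromℕ u)
                           (lift-adj (inj₂ uv∈E)) uw vw , refl , swap

  increasing-pair : ∀ {x y p q : Fin (suc n)} → x ≡ p ⊎ x ≡ q → y ≡ p ⊎ y ≡ q →
                    x < y → p < q → x ≡ p × y ≡ q
  increasing-pair (inj₁ refl) (inj₁ refl) x<y _   = ⊥-elim (ℕₚ.<-irrefl refl x<y)
  increasing-pair (inj₁ x≡p)  (inj₂ y≡q)  _   _   = x≡p , y≡q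
  increasing-pair (inj₂ refl) (inj₁ refl) x<y p<q = ⊥-elim (ℕₚ.<-asym x<y p<q)
  increasing-pair (inj₂ refl) (inj₂ refl) x<y _   = ⊥-elim (ℕₚ.<-irrefl refl x<y)

  listing : Loopless E → TriangleListing E → TriangleListing E′
  listing loopless-E old with new-triangle (loopless-E uv∈E)
  ... | N , cN≡w , base-of-N = record
    { triangles  = N ∷ map lift-triangle triangles
    ; topOrdered = AllProps.map⁺ (All.tabulate (λ {s} _ → N-above s))
                 ∷ AllPairsProps.map⁺ (AllPairs.map inject₁-<⁺ topOrdered)
    ; complete   = complete′
    }
    where
    open TriangleListing old
    N-above : (s : Triangle E) → inject₁ (c s) < c N
    N-above s rewrite cN≡w = inject₁<fromℕ (c s)
    complete′ : ∀ t → ∃ λ s → s ∈ N ∷ map lift-triangle triangles × Triangles.SameCorners E′ s t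
    complete′ (tri x y z x<y y<z xy yz xz) with view z
    ... | ‵fromℕ
      with increasing-pair (base-of-N (neighbour-of-w xz)) (base-of-N (neighbour-of-w yz)) x<y (a<b N)
    ...   | x≡aN , y≡bN = N , here refl , sym x≡aN , sym y≡bN , cN≡w
    complete′ (tri x y z x<y y<z xy yz xz) | ‵inj₁ _ with below-inject₁ y<z
    ... | y₀ , refl with below-inject₁ x<y
    ... | x₀ , refl with complete (tri x₀ y₀ _ (inject₁-<⁻ x<y) (inject₁-<⁻ y<z)
                                      (lower-adj xy) (lower-adj yz) (lower-adj xz))
    ... | s , s∈L , (refl , refl , refl) =
      lift-triangle s , there (∈-map⁺ lift-triangle s∈L) , refl , refl , refl

triangleTree-loopless : ∀ {n E} → TriangleTree n E → Loopless E
triangleTree-loopless root (here refl) ()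
triangleTree-loopless (grow T uv∈E) = Growth.loopless uv∈E (triangleTree-loopless T)

triangleTree-listing : ∀ {n E} → TriangleTree n E → TriangleListing E
triangleTree-listing root = record { triangles = [] ; topOrdered = [] ; complete = no-triangle }
  where
  -- two vertices carry no triangle
  no-triangle : ∀ t → ∃ λ s → s ∈ [] × Triangles.SameCorners _ s t
  no-triangle (tri _ _ zero _ () _ _ _)
  no-triangle (tri _ zero (suc zero) () _ _ _ _)
  no-triangle (tri _ (suc zero) (suc zero) _ (s≤s ()) _ _ _)
triangleTree-listing (grow T uv∈E) =
  Growth.listing uv∈E (triangleTree-loopless T) (triangleTree-listing T)

proposition2p1 : (n : ℕ) (E : List (Edge n)) → TriangleTree n E →
    Σ ℕ (λ k → IsTau E k × IsNu E k)
proposition2p1 n E T = Triangles.τ≡ν E (triangleTree-loopless T) (triangleTree-listing T)
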